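{- Let $P$ be a poset. The following are equivalent: (1) $P$ is normal; (2) there exist a meet-semilattice $S$ and an order-preserving map $f:P\to S$ such that for every $m\in P$, the restriction $f|_{m{\downarrow}}: m{\downarrow}\to f(m){\downarrow}$ is an order isomorphism between $m{\downarrow}$ and $f(m){\downarrow}$.
   Context: For an element $x$ of a poset, $x{\downarrow}=\{a: a\leq x\}$. A binary operation $\cdot$ on a poset $(P,\leq)$ is admissible if for all $x,y\in P$: $x\leq y\iff x\cdot y=x$. A right-normal band is a set with an associative binary operation satisfying $x\cdot x=x$ and $x\cdot y\cdot z=y\cdot x\cdot z$. A poset is normal if it admits an admissible right-normal band operation. -}

module Defs where

open import Level using (Level; _⊔_)
open import Data.Product using (Σ; _×_; _,_; ∃-syntax)
open import Function.Bundles using (_⇔_)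
open import Relation.Binary.Bundles using (Poset)
open import Relation.Binary.Lattice.Bundles using (MeetSemilattice)

module _ {c ℓ₁ ℓ₂ : Level} (P : Poset c ℓ₁ ℓ₂) where
  open Poset P

  record IsAdmissibleRNB (_·_ : Carrier → Carrier → Carrier) : Set (c ⊔ ℓ₁ ⊔ ℓ₂) where
    field
      ·-cong     : ∀ {x x' y y'} → x ≈ x' → y ≈ y' → (x · y) ≈ (x' · y')
      admissible : ∀ x y → (x ≤ y) ⇔ ((x · y) ≈ x)
      ·-assoc    : ∀ x y z → ((x · y) · z) ≈ (x · (y · z))
      ·-idem     : ∀ x → (x · x) ≈ x
      right-normal : ∀ x y z → ((x · y) · z) ≈ ((y · x) · z)

  IsNormal : Set (c ⊔ ℓ₁ ⊔ ℓ₂)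
  IsNormal = Σ (Carrier → Carrier → Carrier) IsAdmissibleRNB

module _ {c ℓ₁ ℓ₂ c' ℓ₁' ℓ₂' : Level}
         (P : Poset c ℓ₁ ℓ₂) (S : MeetSemilattice c' ℓ₁' ℓ₂') where
  private
    module P = Poset P
    module S = MeetSemilattice S

  record IsOrderPreserving (f : P.Carrier → S.Carrier) : Set (c ⊔ ℓ₁ ⊔ ℓ₂ ⊔ ℓ₁' ⊔ ℓ₂') where
    field
      f-cong : ∀ {x y} → x P.≈ y → f x S.≈ f y
      f-mono : ∀ {x y} → x P.≤ y → f x S.≤ f y

  -- the restriction f|_{m↓} : m↓ → f(m)↓ is an order isomorphism:
  -- it is an order embedding (a ≤ b ⇔ f a ≤ f b for a, b ∈ m↓) and it is
  -- surjective onto f(m)↓ (f maps m↓ into f(m)↓ by monotonicity).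
  record IsDownIso (f : P.Carrier → S.Carrier) (m : P.Carrier) : Set (c ⊔ ℓ₁ ⊔ ℓ₂ ⊔ c' ⊔ ℓ₁' ⊔ ℓ₂') where
    field
      maps-into  : ∀ a → a P.≤ m → f a S.≤ f m
      embedding  : ∀ a b → a P.≤ m → b P.≤ m → (a P.≤ b) ⇔ (f a S.≤ f b)
      surjective : ∀ s → s S.≤ f m → ∃[ a ] (a P.≤ m × f a S.≈ s)

  IsLocalIso : (P.Carrier → S.Carrier) → Set (c ⊔ ℓ₁ ⊔ ℓ₂ ⊔ c' ⊔ ℓ₁' ⊔ ℓ₂')
  IsLocalIso f = IsOrderPreserving f × (∀ m → IsDownIso f m)

{-# OPTIONS --safe #-}
module Submission where

-- Given an admissible right-normal band on P, the preorder x ⊑ y :⇔ y · x = x makes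
-- (P, ·) a meet-semilattice once x and y are identified when x ⊑ y ⊑ x, and the
-- identity map is then a local isomorphism: below a fixed m the band operation is
-- commutative, hence ⊑ agrees with ≤ there. Conversely, given a local isomorphism
-- f : P → S, let x · y be the unique element below y whose image is f x ∧ f y; each
-- band law holds because its two sides lie below a common element and have equal
-- images in S.

open import Defs
open import Level using (Level)
open import Data.Product using (Σ; _×_; ∃-syntax; _,_; proj₁; proj₂)
open import Function.Base using (id)
open import Function.Bundles using (mk⇔; Equivalence)
open import Relation.Binary.Bundles using (Poset)
open import Relation.Binary.Structures using (IsEquivalence; IsPartialOrder)
open import Relation.Binary.Lattice.Bundles using (MeetSemilattice)
open import Relation.Binary.Lattice.Definitions using (Infimum)
import Relation.Binary.Lattice.Properties.MeetSemilattice as MeetSemilatticeProperties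
import Relation.Binary.Reasoning.Setoid as SetoidReasoning

module AdmissibleRightNormalBand
  {c ℓ₁ ℓ₂ : Level} (P : Poset c ℓ₁ ℓ₂)
  (_·_ : Poset.Carrier P → Poset.Carrier P → Poset.Carrier P)
  (isAdmissibleRNB : IsAdmissibleRNB P _·_) where

  open Poset P
  open IsAdmissibleRNB isAdmissibleRNB
  open Equivalence
  open SetoidReasoning Eq.setoid

  ·-congˡ : ∀ {x x'} y → x ≈ x' → (x · y) ≈ (x' · y)
  ·-congˡ y x≈x' = ·-cong x≈x' Eq.refl

  ·-congʳ : ∀ x {y y'} → y ≈ y' → (x · y) ≈ (x · y')
  ·-congʳ x y≈y' = ·-cong Eq.refl y≈y'

  x·y·y≈x·y : ∀ x y → ((x · y) · y) ≈ (x · y)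
  x·y·y≈x·y x y = Eq.trans (·-assoc x y y) (·-congʳ x (·-idem y))

  x·[x·y]≈x·y : ∀ x y → (x · (x · y)) ≈ (x · y)
  x·[x·y]≈x·y x y = Eq.trans (Eq.sym (·-assoc x x y)) (·-congˡ y (·-idem x))

  y·[x·y]≈x·y : ∀ x y → (y · (x · y)) ≈ (x · y)
  y·[x·y]≈x·y x y = begin
    y · (x · y)  ≈⟨ ·-assoc y x y ⟨
    (y · x) · y  ≈⟨ right-normal y x y ⟩
    (x · y) · y  ≈⟨ x·y·y≈x·y x y ⟩
    x · y        ∎

  x·y·x≈y·x : ∀ x y → ((x · y) · x) ≈ (y · x)
  x·y·x≈y·x x y = Eq.trans (right-normal x y x) (x·y·y≈x·y y x)

  x·y≤y : ∀ x y → (x · y) ≤ y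
  x·y≤y x y = from (admissible (x · y) y) (x·y·y≈x·y x y)

  ·-comm-below : ∀ {a b m} → a ≤ m → b ≤ m → (a · b) ≈ (b · a)
  ·-comm-below {a} {b} {m} a≤m b≤m = begin
    a · b        ≈⟨ ·-congʳ a (to (admissible b m) b≤m) ⟨
    a · (b · m)  ≈⟨ ·-assoc a b m ⟨
    (a · b) · m  ≈⟨ right-normal a b m ⟩
    (b · a) · m  ≈⟨ ·-assoc b a m ⟩
    b · (a · m)  ≈⟨ ·-congʳ b (to (admissible a m) a≤m) ⟩
    b · a        ∎

  -- Stated with ≤ rather than as y · x ≈ x so that the relation lives at level ℓ₂.
  _⊑_ : Carrier → Carrier → Set ℓ₂
  x ⊑ y = x ≤ (y · x)

  _~_ : Carrier → Carrier → Set ℓ₁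
  x ~ y = ((y · x) ≈ x) × ((x · y) ≈ y)

  ⊑⇒·≈ : ∀ {x y} → x ⊑ y → (y · x) ≈ x
  ⊑⇒·≈ {x} {y} x⊑y = antisym (x·y≤y y x) x⊑y

  ·≈⇒⊑ : ∀ {x y} → (y · x) ≈ x → x ⊑ y
  ·≈⇒⊑ y·x≈x = reflexive (Eq.sym y·x≈x)

  absorbs-trans : ∀ {x y z} → (y · x) ≈ x → (z · y) ≈ y → (z · x) ≈ x
  absorbs-trans {x} {y} {z} y·x≈x z·y≈y = begin
    z · x        ≈⟨ ·-congʳ z y·x≈x ⟨
    z · (y · x)  ≈⟨ ·-assoc z y x ⟨
    (z · y) · x  ≈⟨ ·-congˡ x z·y≈y ⟩
    y · x        ≈⟨ y·x≈x ⟩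
    x            ∎

  ~-isEquivalence : IsEquivalence _~_
  ~-isEquivalence = record
    { refl  = ·-idem _ , ·-idem _
    ; sym   = λ (y·x≈x , x·y≈y) → x·y≈y , y·x≈x
    ; trans = λ (y·x≈x , x·y≈y) (z·y≈y , y·z≈z) →
                absorbs-trans y·x≈x z·y≈y , absorbs-trans y·z≈z x·y≈y
    }

  ⊑-isPartialOrder : IsPartialOrder _~_ _⊑_
  ⊑-isPartialOrder = record
    { isPreorder = record
      { isEquivalence = ~-isEquivalence
      ; reflexive     = λ (y·x≈x , _) → ·≈⇒⊑ y·x≈x
      ; trans         = λ x⊑y y⊑z → ·≈⇒⊑ (absorbs-trans (⊑⇒·≈ x⊑y) (⊑⇒·≈ y⊑z))
      }
    ; antisym = λ x⊑y y⊑x → ⊑⇒·≈ x⊑y , ⊑⇒·≈ y⊑x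
    }

  ·-infimum : Infimum _⊑_ _·_
  ·-infimum x y = ·≈⇒⊑ (x·[x·y]≈x·y x y) , ·≈⇒⊑ (y·[x·y]≈x·y x y) , greatest
    where
    greatest : ∀ z → z ⊑ x → z ⊑ y → z ⊑ (x · y)
    greatest z z⊑x z⊑y = ·≈⇒⊑ (begin
      (x · y) · z  ≈⟨ ·-assoc x y z ⟩
      x · (y · z)  ≈⟨ ·-congʳ x (⊑⇒·≈ z⊑y) ⟩
      x · z        ≈⟨ ⊑⇒·≈ z⊑x ⟩
      z            ∎)

  semilattice : MeetSemilattice c ℓ₁ ℓ₂
  semilattice = record
    { _≈_ = _~_
    ; _≤_ = _⊑_
    ; _∧_ = _·_
    ; isMeetSemilattice = record
      { isPartialOrder = ⊑-isPartialOrder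
      ; infimum        = ·-infimum
      }
    }

  ≈⇒~ : ∀ {x y} → x ≈ y → x ~ y
  ≈⇒~ {x} {y} x≈y = Eq.trans (·-congˡ x (Eq.sym x≈y)) (·-idem x)
                  , Eq.trans (·-congˡ y x≈y) (·-idem y)

  ≤⇒⊑ : ∀ {x y} → x ≤ y → x ⊑ y
  ≤⇒⊑ {x} {y} x≤y = ·≈⇒⊑ (begin
    y · x        ≈⟨ ·-congʳ y x·y≈x ⟨
    y · (x · y)  ≈⟨ y·[x·y]≈x·y x y ⟩
    x · y        ≈⟨ x·y≈x ⟩
    x            ∎)
    where x·y≈x = to (admissible x y) x≤y

  ⊑⇒≤-below : ∀ {a b m} → a ≤ m → b ≤ m → a ⊑ b → a ≤ b
  ⊑⇒≤-below {a} {b} a≤m b≤m a⊑b =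
    from (admissible a b) (Eq.trans (·-comm-below a≤m b≤m) (⊑⇒·≈ a⊑b))

  id-isDownIso : ∀ m → IsDownIso P semilattice id m
  id-isDownIso m = record
    { maps-into  = λ _ → ≤⇒⊑
    ; embedding  = λ _ _ a≤m b≤m → mk⇔ ≤⇒⊑ (⊑⇒≤-below a≤m b≤m)
    ; surjective = λ s s⊑m →
        s · m , x·y≤y s m , x·[x·y]≈x·y s m , Eq.trans (x·y·x≈y·x s m) (⊑⇒·≈ s⊑m)
    }

  id-isLocalIso : IsLocalIso P semilattice id
  id-isLocalIso = record { f-cong = ≈⇒~ ; f-mono = ≤⇒⊑ } , id-isDownIso

module LocalIsomorphism
  {c ℓ₁ ℓ₂ c' ℓ₁' ℓ₂' : Level} (P : Poset c ℓ₁ ℓ₂) (S : MeetSemilattice c' ℓ₁' ℓ₂')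
  (f : Poset.Carrier P → MeetSemilattice.Carrier S) (isLocalIso : IsLocalIso P S f) where

  private
    module P = Poset P
    module S = MeetSemilattice S
    module SP = MeetSemilatticeProperties S
    module D m = IsDownIso (proj₂ isLocalIso m)
  open Equivalence
  open IsOrderPreserving (proj₁ isLocalIso)
  open SetoidReasoning (Poset.Eq.setoid S.poset)

  ≈-below : ∀ {a b m} → a P.≤ m → b P.≤ m → f a S.≈ f b → a P.≈ b
  ≈-below {a} {b} {m} a≤m b≤m fa≈fb =
    P.antisym (from (D.embedding m a b a≤m b≤m) (S.reflexive fa≈fb))
              (from (D.embedding m b a b≤m a≤m) (S.reflexive (S.Eq.sym fa≈fb)))

  meet-below : ∀ x y → ∃[ a ] (a P.≤ y × f a S.≈ (f x S.∧ f y))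
  meet-below x y = D.surjective y (f x S.∧ f y) (S.x∧y≤y (f x) (f y))

  _·_ : P.Carrier → P.Carrier → P.Carrier
  x · y = proj₁ (meet-below x y)

  x·y≤y : ∀ x y → (x · y) P.≤ y
  x·y≤y x y = proj₁ (proj₂ (meet-below x y))

  f[x·y]≈fx∧fy : ∀ x y → f (x · y) S.≈ (f x S.∧ f y)
  f[x·y]≈fx∧fy x y = proj₂ (proj₂ (meet-below x y))

  ·-cong : ∀ {x x' y y'} → x P.≈ x' → y P.≈ y' → (x · y) P.≈ (x' · y')
  ·-cong {x} {x'} {y} {y'} x≈x' y≈y' =
    ≈-below (P.trans (x·y≤y x y) (P.reflexive y≈y')) (x·y≤y x' y') (begin
      f (x · y)      ≈⟨ f[x·y]≈fx∧fy x y ⟩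
      f x S.∧ f y    ≈⟨ SP.∧-cong (f-cong x≈x') (f-cong y≈y') ⟩
      f x' S.∧ f y'  ≈⟨ f[x·y]≈fx∧fy x' y' ⟨
      f (x' · y')    ∎)

  ≤⇒x·y≈x : ∀ {x y} → x P.≤ y → (x · y) P.≈ x
  ≤⇒x·y≈x {x} {y} x≤y = ≈-below (x·y≤y x y) x≤y (begin
    f (x · y)    ≈⟨ f[x·y]≈fx∧fy x y ⟩
    f x S.∧ f y  ≈⟨ SP.∧-comm (f x) (f y) ⟩
    f y S.∧ f x  ≈⟨ SP.y≤x⇒x∧y≈y (f-mono x≤y) ⟩
    f x          ∎)

  x·y≈x⇒≤ : ∀ {x y} → (x · y) P.≈ x → x P.≤ y
  x·y≈x⇒≤ {x} {y} x·y≈x = P.trans (P.reflexive (P.Eq.sym x·y≈x)) (x·y≤y x y)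

  ·-assoc : ∀ x y z → ((x · y) · z) P.≈ (x · (y · z))
  ·-assoc x y z =
    ≈-below (x·y≤y (x · y) z) (P.trans (x·y≤y x (y · z)) (x·y≤y y z)) (begin
      f ((x · y) · z)        ≈⟨ f[x·y]≈fx∧fy (x · y) z ⟩
      f (x · y) S.∧ f z      ≈⟨ SP.∧-cong (f[x·y]≈fx∧fy x y) S.Eq.refl ⟩
      (f x S.∧ f y) S.∧ f z  ≈⟨ SP.∧-assoc (f x) (f y) (f z) ⟩
      f x S.∧ (f y S.∧ f z)  ≈⟨ SP.∧-cong S.Eq.refl (f[x·y]≈fx∧fy y z) ⟨
      f x S.∧ f (y · z)      ≈⟨ f[x·y]≈fx∧fy x (y · z) ⟨
      f (x · (y · z))        ∎)

  ·-idem : ∀ x → (x · x) P.≈ x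
  ·-idem x = ≤⇒x·y≈x P.refl

  right-normal : ∀ x y z → ((x · y) · z) P.≈ ((y · x) · z)
  right-normal x y z = ≈-below (x·y≤y (x · y) z) (x·y≤y (y · x) z) (begin
    f ((x · y) · z)    ≈⟨ f[x·y]≈fx∧fy (x · y) z ⟩
    f (x · y) S.∧ f z  ≈⟨ SP.∧-cong f[x·y]≈f[y·x] S.Eq.refl ⟩
    f (y · x) S.∧ f z  ≈⟨ f[x·y]≈fx∧fy (y · x) z ⟨
    f ((y · x) · z)    ∎)
    where
    f[x·y]≈f[y·x] : f (x · y) S.≈ f (y · x)
    f[x·y]≈f[y·x] = begin
      f (x · y)    ≈⟨ f[x·y]≈fx∧fy x y ⟩
      f x S.∧ f y  ≈⟨ SP.∧-comm (f x) (f y) ⟩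
      f y S.∧ f x  ≈⟨ f[x·y]≈fx∧fy y x ⟨
      f (y · x)    ∎

  isAdmissibleRNB : IsAdmissibleRNB P _·_
  isAdmissibleRNB = record
    { ·-cong       = ·-cong
    ; admissible   = λ _ _ → mk⇔ ≤⇒x·y≈x x·y≈x⇒≤
    ; ·-assoc      = ·-assoc
    ; ·-idem       = ·-idem
    ; right-normal = right-normal
    }

theorem3p2 : ∀ {c ℓ₁ ℓ₂ c' ℓ₁' ℓ₂' : Level} (P : Poset c ℓ₁ ℓ₂) →
    (IsNormal P →
      Σ (MeetSemilattice c ℓ₁ ℓ₂) λ S → ∃[ f ] IsLocalIso P S f)
    × ((S : MeetSemilattice c' ℓ₁' ℓ₂') (f : Poset.Carrier P → MeetSemilattice.Carrier S) →
      IsLocalIso P S f → IsNormal P)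
theorem3p2 P = normal⇒localIso , localIso⇒normal
  where
  normal⇒localIso : IsNormal P → Σ (MeetSemilattice _ _ _) λ S → ∃[ f ] IsLocalIso P S f
  normal⇒localIso (_·_ , isAdmissibleRNB) =
    semilattice , id , id-isLocalIso
    where open AdmissibleRightNormalBand P _·_ isAdmissibleRNB

  localIso⇒normal : ∀ S f → IsLocalIso P S f → IsNormal P
  localIso⇒normal S f isLocalIso = _·_ , isAdmissibleRNB
    where open LocalIsomorphism P S f isLocalIso
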